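{- Let $\mathcal B,\mathcal C,\mathcal D$ be syntactical classes and let $\mathcal F,\mathcal G$ be countable families of (partial) functions $\mathbb N\to\mathbb N$, each given with a fixed (not necessarily injective) enumeration, and both containing the identity function $Id:\mathbb N\to\mathbb N$. Let $e,f,g,h:\mathbb N\to\mathbb N$ be total functions. 1. (i) If $e\prec^{\mathcal F}_{\mathcal B,\mathcal C} f$ and $f\prec^{\mathcal G}_{\mathcal C,\mathcal D} g$ then $e\prec^{\mathcal G}_{\mathcal B,\mathcal D} g$. (ii) If $e\prec^{\mathcal F\uparrow}_{\mathcal B,\mathcal C} f$ and $f\prec^{\mathcal G\uparrow}_{\mathcal C,\mathcal D} g$ then $e\prec^{\mathcal G\uparrow}_{\mathcal B,\mathcal D} g$ and $e\prec^{\mathcal F\uparrow}_{\mathcal B,\mathcal D} g$. (iii) If $\mathcal F$ is recursively closed by negative translation of the output, then $e\le_{\rm ct} f$ and $f\prec^{\mathcal F}_{\mathcal C,\mathcal D} g$ imply $e\prec^{\mathcal F}_{\mathcal C,\mathcal D} g$. (iv) If $\mathcal F$ is recursively closed by negative translation of the output and by negative translation of the input, then $e\le_{\rm ct} f$, $f\prec^{\mathcal F\uparrow}_{\mathcal C,\mathcal D} g$ and $g\le_{\rm ct} h$ imply $e\prec^{\mathcal F\uparrow}_{\mathcal C,\mathcal D} h$. 2. For every syntactical class $\mathcal C$, the relations $\prec^{\mathcal F}_{\mathcal C,\mathcal C}$ and $\prec^{\mathcal F\uparrow}_{\mathcal C,\mathcal C}$ are strict orderings (irreflexive and transitive) on total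 functions $\mathbb N\to\mathbb N$.
   Context: For total $f,g$: $f\le_{\rm ct} g$ iff $\exists c\,\forall x\ f(x)\le g(x)+c$. Syntactical classes. Fix a recursive pairing $\langle\cdot,\cdot\rangle$ and acceptable enumerations $(W_i)$ of r.e. subsets of $\mathbb N$ and of each $\mathbb N\times(\{0,1\}^*)^m$. A syntactical class is one of $\Sigma^0_1,\Pi^0_1,\Sigma^0_1\vee\Pi^0_1,\exists^{\le\mu}(\Sigma^0_1\wedge\Pi^0_1)$ (for a fixed total monotone increasing $\mu:\mathbb N\to\mathbb N$), each with the enumeration $(W^{\mathcal C}_i)$ of subsets of $\mathbb N$: $W^{\Sigma^0_1}_i=W_i$; $W^{\Pi^0_1}_i=\mathbb N\setminus W_i$; $W^{\Sigma^0_1\vee\Pi^0_1}_{\langle j,k\rangle}=W_j\cup(\mathbb N\setminus W_k)$; $W^{\exists^{\le\mu}(\Sigma^0_1\wedge\Pi^0_1)}_{\langle\langle j,k\rangle,m\rangle}=\{x:\exists u_1,\dots,u_m\in\{0,1\}^*\,(\forall l\ |u_l|\le\mu(x)\wedge (x,\vec u)\in W_j\setminus W_k)\}$ where $W_j,W_k$ enumerate r.e. subsets of $\mathbb N\times(\{0,1\}^*)^m$. Relations. Let $(\phi_i)$ be the enumeration of $\mathcal F$. $f\prec^{\mathcal F}_{\mathcal C,\mathcal D} g$ means: (a) for every total $\phi\in\mathcal F$ tending to $+\infty$, the set $\{x:f(x)<\phi(g(x))\}$ is constructively $(\mathcal C,\mathcal D)$-dense, i.e. there is a total recursive $\lambda$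 such that for all $j$, if $W^{\mathcal C}_j$ is infinite then $W^{\mathcal D}_{\lambda(j)}$ is an infinite subset of $W^{\mathcal C}_j\cap\{x:f(x)<\phi(g(x))\}$; and (b) uniformly: there is a total recursive $\lambda:\mathbb N^2\to\mathbb N$ such that for all $i,j$, if $\phi_i$ is total and tends to $+\infty$ and $W^{\mathcal C}_j$ is infinite, then $W^{\mathcal D}_{\lambda(i,j)}$ is an infinite subset of $W^{\mathcal C}_j\cap\{x:f(x)<\phi_i(g(x))\}$. The relation $f\prec^{\mathcal F\uparrow}_{\mathcal C,\mathcal D}g$ is defined identically except that only functions $\phi,\phi_i$ which are moreover monotone increasing are considered. $\mathcal F$ is recursively closed by negative translation of the output if $\phi\in\mathcal F$ implies $\max(0,\phi-c)\in\mathcal F$ for all $c$ and there is a total recursive $\theta$ with $\max(0,\phi_i-c)=\phi_{\theta(i,c)}$; it is recursively closed by negative translation of the input if $x\mapsto\phi(\max(0,x-c))\in\mathcal F$ for all $\phi\in\mathcal F$, $c$, and there is a total recursive $\zeta$ with $\phi_i(\max(0,x-c))=\phi_{\zeta(i,c)}(x)$ for all $x$. -}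

module Defs where

open import Data.Nat using (ℕ; zero; suc; _+_; _*_; _∸_; _≤_; _<_; _<?_)
open import Data.Fin using (Fin; fromℕ<)
open import Data.Vec using (Vec; []; _∷_; lookup)
open import Data.Vec.Relation.Unary.All using (All)
open import Data.List using (List; length)
open import Data.Bool using (Bool; true; false)
open import Data.Maybe using (Maybe; just; nothing)
import Data.Maybe as Maybe
open import Data.Product using (Σ; _×_; _,_; proj₁; proj₂)
open import Data.Sum using (_⊎_)
open import Data.Unit using (⊤)
open import Relation.Nullary using (¬_; yes; no)
open import Relation.Binary.PropositionalEquality using (_≡_)

tri : ℕ → ℕ
tri zero    = zero
tri (suc n) = tri n + suc n

pair : ℕ → ℕ → ℕ
pair x y = tri (x + y) + y

-- inverse of pair (enumerates the diagonals (d,0),(d-1,1),…,(0,d))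
unpair : ℕ → ℕ × ℕ
unpair zero = 0 , 0
unpair (suc z) with unpair z
... | zero  , y = suc y , 0
... | suc x , y = x , suc y

data PR : ℕ → Set where
  zeroF : ∀ {n} → PR n
  succF : PR 1
  projF : ∀ {n} → Fin n → PR n
  compF : ∀ {n k} → PR k → Vec (PR n) k → PR n
  recF  : ∀ {n} → PR n → PR (suc (suc n)) → PR (suc n)
  muF   : ∀ {n} → PR (suc n) → PR n

infix 4 _⊢_⇓_ _⊢_⇓*_

mutual
  data _⊢_⇓_ : ∀ {n} → PR n → Vec ℕ n → ℕ → Set where
    ⇓zero : ∀ {n} {xs : Vec ℕ n} → zeroF ⊢ xs ⇓ 0
    ⇓succ : ∀ {x} → succF ⊢ x ∷ [] ⇓ suc x
    ⇓proj : ∀ {n} (i : Fin n) {xs : Vec ℕ n} → projF i ⊢ xs ⇓ lookup xs i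
    ⇓comp : ∀ {n k} {f : PR k} {gs : Vec (PR n) k} {xs : Vec ℕ n} {ys : Vec ℕ k} {v} →
            gs ⊢ xs ⇓* ys → f ⊢ ys ⇓ v → compF f gs ⊢ xs ⇓ v
    ⇓rec0 : ∀ {n} {f : PR n} {g : PR (suc (suc n))} {xs : Vec ℕ n} {v} →
            f ⊢ xs ⇓ v → recF f g ⊢ 0 ∷ xs ⇓ v
    ⇓recS : ∀ {n} {f : PR n} {g : PR (suc (suc n))} {xs : Vec ℕ n} {y w v} →
            recF f g ⊢ y ∷ xs ⇓ w → g ⊢ y ∷ w ∷ xs ⇓ v → recF f g ⊢ suc y ∷ xs ⇓ v
    ⇓mu   : ∀ {n} {f : PR (suc n)} {xs : Vec ℕ n} {y} →
            f ⊢ y ∷ xs ⇓ 0 →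
            (∀ m → m < y → Σ ℕ λ k → f ⊢ m ∷ xs ⇓ suc k) →
            muF f ⊢ xs ⇓ y

  data _⊢_⇓*_ : ∀ {n k} → Vec (PR n) k → Vec ℕ n → Vec ℕ k → Set where
    []⇓ : ∀ {n} {xs : Vec ℕ n} → [] ⊢ xs ⇓* []
    ∷⇓  : ∀ {n k} {g : PR n} {gs : Vec (PR n) k} {xs : Vec ℕ n} {v vs} →
          g ⊢ xs ⇓ v → gs ⊢ xs ⇓* vs → (g ∷ gs) ⊢ xs ⇓* (v ∷ vs)

-- Gödel numbering of terms (effective and surjective; the fuel argument
-- is only a termination device: with fuel = code every term is reached).

toFin : (n : ℕ) → ℕ → Maybe (Fin n)
toFin n p with p <? n
... | yes p<n = just (fromℕ< p<n)
... | no  _   = nothing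

mutual
  decF : ℕ → (n : ℕ) → ℕ → PR n
  decF zero     n c       = zeroF
  decF (suc fu) n zero    = zeroF
  decF (suc fu) n (suc c) = decTag fu n (proj₁ (unpair c)) (proj₂ (unpair c))

  decTag : ℕ → (n : ℕ) → ℕ → ℕ → PR n
  decTag fu n 0 p = zeroF
  decTag fu 1 1 p = succF
  decTag fu n 2 p with toFin n p
  ... | just i  = projF i
  ... | nothing = zeroF
  decTag fu n 3 p = compF (decF fu k (proj₁ (unpair r))) (decVec fu n k (proj₂ (unpair r)))
    where
      k = proj₁ (unpair p)
      r = proj₂ (unpair p)
  decTag fu (suc m) 4 p = recF (decF fu m (proj₁ (unpair p))) (decF fu (suc (suc m)) (proj₂ (unpair p)))
  decTag fu n 5 p = muF (decF fu (suc n) p)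
  decTag fu n t p = zeroF

  decVec : ℕ → (n k : ℕ) → ℕ → Vec (PR n) k
  decVec fu n zero    c = []
  decVec fu n (suc k) c = decF fu n (proj₁ (unpair c)) ∷ decVec fu n k (proj₂ (unpair c))

dec : (n : ℕ) → ℕ → PR n
dec n c = decF c n c

Recursive₁ : (ℕ → ℕ) → Set
Recursive₁ λ₀ = Σ (PR 1) λ p → ∀ x → p ⊢ x ∷ [] ⇓ λ₀ x

Recursive₂ : (ℕ → ℕ → ℕ) → Set
Recursive₂ λ₀ = Σ (PR 2) λ p → ∀ x y → p ⊢ x ∷ y ∷ [] ⇓ λ₀ x y

W : ℕ → ℕ → Set
W j x = Σ ℕ λ v → dec 1 j ⊢ x ∷ [] ⇓ v

codeBS : List Bool → ℕ
codeBS List.[]          = 0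
codeBS (false List.∷ u) = suc (2 * codeBS u)
codeBS (true  List.∷ u) = suc (suc (2 * codeBS u))

codeWords : ∀ {m} → Vec (List Bool) m → ℕ
codeWords []       = 0
codeWords (u ∷ us) = pair (codeBS u) (codeWords us)

Wtup : (m : ℕ) → ℕ → ℕ → Vec (List Bool) m → Set
Wtup m j x us = W j (pair x (codeWords us))

MonotoneIncr : (ℕ → ℕ) → Set
MonotoneIncr μ = ∀ x y → x ≤ y → μ x ≤ μ y

data SynClass : Set where
  Σ⁰₁   : SynClass
  Π⁰₁   : SynClass
  Σ⁰₁∨Π⁰₁ : SynClass
  ∃≤[_,_]Σ⁰₁∧Π⁰₁ : (μ : ℕ → ℕ) → MonotoneIncr μ → SynClass

WC : SynClass → ℕ → ℕ → Set
WC Σ⁰₁ i x = W i x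
WC Π⁰₁ i x = ¬ W i x
WC Σ⁰₁∨Π⁰₁ i x = W (proj₁ (unpair i)) x ⊎ ¬ W (proj₂ (unpair i)) x
WC ∃≤[ μ , _ ]Σ⁰₁∧Π⁰₁ i x =
  Σ (Vec (List Bool) m) λ us →
    All (λ u → length u ≤ μ x) us × Wtup m j x us × ¬ Wtup m k x us
  where
    jk = proj₁ (unpair i)
    m  = proj₂ (unpair i)
    j  = proj₁ (unpair jk)
    k  = proj₂ (unpair jk)

Infinite : (ℕ → Set) → Set
Infinite P = ∀ n → Σ ℕ λ x → n ≤ x × P x

Partial : Set
Partial = ℕ → Maybe ℕ

Family : Set
Family = ℕ → Partial

InFamily : Family → Partial → Set
InFamily 𝓕 φ = Σ ℕ λ i → ∀ x → 𝓕 i x ≡ φ x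

Id : Partial
Id x = just x

Total : Partial → Set
Total φ = ∀ x → Σ ℕ λ v → φ x ≡ just v

TendsToInfinity : Partial → Set
TendsToInfinity φ = ∀ n → Σ ℕ λ N → ∀ x v → N ≤ x → φ x ≡ just v → n ≤ v

MonotoneIncrP : Partial → Set
MonotoneIncrP φ = ∀ x y v w → x ≤ y → φ x ≡ just v → φ y ≡ just w → v ≤ w

Admissible : Partial → Set
Admissible φ = Total φ × TendsToInfinity φ

AdmissibleUp : Partial → Set
AdmissibleUp φ = Total φ × TendsToInfinity φ × MonotoneIncrP φ

LtAt : (ℕ → ℕ) → Partial → (ℕ → ℕ) → ℕ → Set
LtAt f φ g x = Σ ℕ λ v → φ (g x) ≡ just v × f x < v

DenseWitness : SynClass → SynClass → (ℕ → ℕ) → Partial → (ℕ → ℕ) → ℕ → ℕ → Set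
DenseWitness 𝒞 𝒟 f φ g j l =
  Infinite (WC 𝒞 j) →
  Infinite (WC 𝒟 l) × (∀ x → WC 𝒟 l x → WC 𝒞 j x × LtAt f φ g x)

PrecWith : (Partial → Set) → Family → SynClass → SynClass → (ℕ → ℕ) → (ℕ → ℕ) → Set
PrecWith Adm 𝓕 𝒞 𝒟 f g =
  (∀ φ → InFamily 𝓕 φ → Adm φ →
     Σ (ℕ → ℕ) λ λ₀ → Recursive₁ λ₀ × (∀ j → DenseWitness 𝒞 𝒟 f φ g j (λ₀ j)))
  ×
  (Σ (ℕ → ℕ → ℕ) λ λ₀ → Recursive₂ λ₀ ×
     (∀ i j → Adm (𝓕 i) → DenseWitness 𝒞 𝒟 f (𝓕 i) g j (λ₀ i j)))

Prec : Family → SynClass → SynClass → (ℕ → ℕ) → (ℕ → ℕ) → Set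
Prec = PrecWith Admissible

PrecUp : Family → SynClass → SynClass → (ℕ → ℕ) → (ℕ → ℕ) → Set
PrecUp = PrecWith AdmissibleUp

_≤ct_ : (ℕ → ℕ) → (ℕ → ℕ) → Set
f ≤ct g = Σ ℕ λ c → ∀ x → f x ≤ g x + c

ClosedNegOut : Family → Set
ClosedNegOut 𝓕 =
  (∀ φ c → InFamily 𝓕 φ → InFamily 𝓕 (λ x → Maybe.map (_∸ c) (φ x)))
  × (Σ (ℕ → ℕ → ℕ) λ θ → Recursive₂ θ ×
       (∀ i c x → 𝓕 (θ i c) x ≡ Maybe.map (_∸ c) (𝓕 i x)))

ClosedNegIn : Family → Set
ClosedNegIn 𝓕 =
  (∀ φ c → InFamily 𝓕 φ → InFamily 𝓕 (λ x → φ (x ∸ c)))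
  × (Σ (ℕ → ℕ → ℕ) λ ζ → Recursive₂ ζ ×
       (∀ i c x → 𝓕 (ζ i c) x ≡ 𝓕 i (x ∸ c)))

-- Transitivity: applying e ≺ f at φ = Id makes {x : e x < f x} constructively dense, and inside
-- it f ≺ g yields a dense subset of {x : f x < φ (g x)} ⊆ {x : e x < φ (g x)}; the recursive
-- index maps compose. Keeping the family of e ≺ f instead, f ≺ g is used at Id, and monotonicity
-- of φ turns e x < φ (f x) and f x < g x into e x < φ (g x). For (iii) and (iv), e ≤ f + c and
-- g ≤ h + d reduce e ≺ h against φ to f ≺ g against x ↦ φ (x ∸ d) ∸ c, which lies in the family
-- by the closure hypotheses. Irreflexivity: every syntactical class has an index for all of ℕ,
-- so u ≺ u at φ = Id would produce a point x with u x < u x.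
module Submission where

open import Defs
open import Data.Nat using (ℕ)
open import Data.Product using (_×_)
open import Relation.Nullary using (¬_)

open import Data.Nat using (zero; suc; _+_; _∸_; _≤_; _<_; s≤s)
open import Data.Nat.Properties
open import Data.Product using (Σ; ∃; _,_; proj₁; proj₂)
open import Data.Sum using (inj₁)
open import Data.Vec using (Vec; []; _∷_)
open import Data.Vec.Relation.Unary.All using ([])
open import Data.Fin using (zero; suc)
open import Data.Maybe using (Maybe; just)
import Data.Maybe as Maybe
open import Data.Maybe.Properties using (just-injective)
open import Function using (_∘_)
open import Relation.Binary.PropositionalEquality

private variable
  𝓑 𝒞 𝒟 : SynClass
  𝓕 𝓖 : Family
  Adm : Partial → Set
  a b e f g h u : ℕ → ℕ
  a₂ : ℕ → ℕ → ℕ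
  φ ψ : Partial
  c d j k l m n w x y z : ℕ
  p : Maybe ℕ
  P Q R : ℕ → Set

unpair-suc : ∀ z {x y} → unpair z ≡ (suc x , y) → unpair (suc z) ≡ (x , suc y)
unpair-suc z eq rewrite eq = refl

unpair-suc-zero : ∀ z {y} → unpair z ≡ (0 , y) → unpair (suc z) ≡ (suc y , 0)
unpair-suc-zero z eq rewrite eq = refl

unpair-tri : ∀ d → unpair (tri d) ≡ (d , 0)

unpair-tri+ : ∀ d y → y ≤ d → unpair (tri d + y) ≡ (d ∸ y , y)
unpair-tri+ d zero _ rewrite +-identityʳ (tri d) = unpair-tri d
unpair-tri+ (suc d) (suc y) (s≤s y≤d) = begin
  unpair (tri (suc d) + suc y)    ≡⟨ cong unpair (+-suc (tri (suc d)) y) ⟩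
  unpair (suc (tri (suc d) + y))  ≡⟨ unpair-suc (tri (suc d) + y)
                                       (trans (unpair-tri+ (suc d) y (m≤n⇒m≤1+n y≤d))
                                              (cong (_, y) (+-∸-assoc 1 y≤d))) ⟩
  (d ∸ y , suc y)                 ∎
  where open ≡-Reasoning

unpair-tri zero = refl
unpair-tri (suc d) = begin
  unpair (tri d + suc d)    ≡⟨ cong unpair (+-suc (tri d) d) ⟩
  unpair (suc (tri d + d))  ≡⟨ unpair-suc-zero (tri d + d)
                                 (trans (unpair-tri+ d d ≤-refl) (cong (_, d) (n∸n≡0 d))) ⟩
  (suc d , 0)               ∎
  where open ≡-Reasoning

unpair-pair : ∀ x y → unpair (pair x y) ≡ (x , y)
unpair-pair x y =
  trans (unpair-tri+ (x + y) y (m≤n+m y x)) (cong (_, y) (m+n∸n≡m x y))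

constant : ∀ {n} → ℕ → PR n
constant zero    = zeroF
constant (suc k) = compF succF (constant k ∷ [])

constant-⇓ : ∀ {n} k {xs : Vec ℕ n} → constant k ⊢ xs ⇓ k
constant-⇓ zero    = ⇓zero
constant-⇓ (suc k) = ⇓comp (∷⇓ (constant-⇓ k) []⇓) ⇓succ

Recursive₁-∘ : Recursive₁ a → Recursive₁ b → Recursive₁ (a ∘ b)
Recursive₁-∘ {b = b} (p , p⇓) (q , q⇓) = compF p (q ∷ []) , λ x → ⇓comp (∷⇓ (q⇓ x) []⇓) (p⇓ (b x))

Recursive₁-∘₂ : Recursive₁ a → Recursive₂ a₂ → Recursive₂ (λ i j → a (a₂ i j))
Recursive₁-∘₂ {a₂ = a₂} (p , p⇓) (q , q⇓) =
  compF p (q ∷ []) , λ i j → ⇓comp (∷⇓ (q⇓ i j) []⇓) (p⇓ (a₂ i j))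

Recursive₂-∘ˡ : Recursive₂ a₂ → Recursive₁ b → Recursive₂ (λ i j → a₂ (b i) j)
Recursive₂-∘ˡ {b = b} (p , p⇓) (q , q⇓) =
  compF p (compF q (projF zero ∷ []) ∷ projF (suc zero) ∷ []) ,
  λ i j → ⇓comp (∷⇓ (⇓comp (∷⇓ (⇓proj zero) []⇓) (q⇓ i)) (∷⇓ (⇓proj (suc zero)) []⇓)) (p⇓ (b i) j)

Recursive₂-∘ʳ : Recursive₂ a₂ → Recursive₁ b → Recursive₂ (λ i j → a₂ i (b j))
Recursive₂-∘ʳ {b = b} (p , p⇓) (q , q⇓) =
  compF p (projF zero ∷ compF q (projF (suc zero) ∷ []) ∷ []) ,
  λ i j → ⇓comp (∷⇓ (⇓proj zero) (∷⇓ (⇓comp (∷⇓ (⇓proj (suc zero)) []⇓) (q⇓ j)) []⇓)) (p⇓ i (b j))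

Recursive₂-fixʳ : Recursive₂ a₂ → ∀ c → Recursive₁ (λ i → a₂ i c)
Recursive₂-fixʳ (p , p⇓) c =
  compF p (projF zero ∷ constant c ∷ []) ,
  λ i → ⇓comp (∷⇓ (⇓proj zero) (∷⇓ (constant-⇓ c) []⇓)) (p⇓ i c)

DenseWitnessOf : SynClass → SynClass → (ℕ → Set) → ℕ → ℕ → Set
DenseWitnessOf 𝒞 𝒟 P j l = Infinite (WC 𝒞 j) → Infinite (WC 𝒟 l) × (∀ x → WC 𝒟 l x → WC 𝒞 j x × P x)

ConstructivelyDense : SynClass → SynClass → (ℕ → Set) → Set
ConstructivelyDense 𝒞 𝒟 P = Σ (ℕ → ℕ) λ λ₀ → Recursive₁ λ₀ × (∀ j → DenseWitnessOf 𝒞 𝒟 P j (λ₀ j))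

DenseWitnessOf-trans : (∀ x → P x → Q x → R x) →
  DenseWitnessOf 𝓑 𝒞 P j l → DenseWitnessOf 𝒞 𝒟 Q l m → DenseWitnessOf 𝓑 𝒟 R j m
DenseWitnessOf-trans combine w₁ w₂ infB =
  let infC , subC = w₁ infB
      infD , subD = w₂ infC
  in infD , λ x xD → let xC , Qx = subD x xD
                         xB , Px = subC x xC
                     in xB , combine x Px Qx

DenseWitnessOf-weaken : (∀ x → P x → Q x) → DenseWitnessOf 𝒞 𝒟 P j l → DenseWitnessOf 𝒞 𝒟 Q j l
DenseWitnessOf-weaken P⇒Q w inf =
  let infD , sub = w inf
  in infD , λ x xD → let xC , Px = sub x xD in xC , P⇒Q x Px

ConstructivelyDense-trans : (∀ x → P x → Q x → R x) →
  ConstructivelyDense 𝓑 𝒞 P → ConstructivelyDense 𝒞 𝒟 Q → ConstructivelyDense 𝓑 𝒟 R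
ConstructivelyDense-trans combine (l₁ , rec₁ , w₁) (l₂ , rec₂ , w₂) =
  l₂ ∘ l₁ , Recursive₁-∘ rec₂ rec₁ , λ j → DenseWitnessOf-trans combine (w₁ j) (w₂ (l₁ j))

ConstructivelyDense-weaken : (∀ x → P x → Q x) →
  ConstructivelyDense 𝒞 𝒟 P → ConstructivelyDense 𝒞 𝒟 Q
ConstructivelyDense-weaken P⇒Q (l , rec , w) = l , rec , λ j → DenseWitnessOf-weaken P⇒Q (w j)

-- LtAt f φ g x unfolds to f x <ᵐ φ (g x); stating the lemmas on values lets Agda infer their
-- arguments.
_<ᵐ_ : ℕ → Maybe ℕ → Set
n <ᵐ m = Σ ℕ λ v → m ≡ just v × n < v

<ᵐ-just⇒< : n <ᵐ just m → n < m
<ᵐ-just⇒< {n} (v , eq , n<v) = subst (n <_) (sym (just-injective eq)) n<v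

≤-<ᵐ-trans : k ≤ n → n <ᵐ p → k <ᵐ p
≤-<ᵐ-trans k≤n (v , eq , n<v) = v , eq , ≤-<-trans k≤n n<v

<ᵐ-≤-trans : Total φ → MonotoneIncrP φ → n <ᵐ φ y → y ≤ z → n <ᵐ φ z
<ᵐ-≤-trans {y = y} {z} total mono (v , eq , n<v) y≤z =
  let w , eq′ = total z in w , eq′ , <-≤-trans n<v (mono y z v w y≤z eq eq′)

Admissible-Id : Admissible Id
Admissible-Id = (λ x → x , refl) , λ n → n , λ x v n≤x eq → subst (n ≤_) (just-injective eq) n≤x

AdmissibleUp-Id : AdmissibleUp Id
AdmissibleUp-Id = proj₁ Admissible-Id , proj₂ Admissible-Id ,
  λ x y v w x≤y eqx eqy → subst₂ _≤_ (just-injective eqx) (just-injective eqy) x≤y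

PrecWith-trans : InFamily 𝓕 Id → Adm Id →
  PrecWith Adm 𝓕 𝓑 𝒞 e f → PrecWith Adm 𝓖 𝒞 𝒟 f g → PrecWith Adm 𝓖 𝓑 𝒟 e g
PrecWith-trans {e = e} {f = f} {𝓖 = 𝓖} {g = g} Id∈𝓕 admId (dense₁ , _) (dense₂ , l₂ , rec₂ , uniform₂)
  with dense₁ Id Id∈𝓕 admId
... | e<f@(l₁ , rec₁ , w₁) =
  (λ φ φ∈𝓖 admφ → ConstructivelyDense-trans (combine φ) e<f (dense₂ φ φ∈𝓖 admφ))
  , (λ i j → l₂ i (l₁ j)) , Recursive₂-∘ʳ rec₂ rec₁
  , λ i j admᵢ → DenseWitnessOf-trans (combine (𝓖 i)) (w₁ j) (uniform₂ i (l₁ j) admᵢ)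
  where
  combine : ∀ φ x → LtAt e Id f x → LtAt f φ g x → LtAt e φ g x
  combine φ x e<f f<φg = ≤-<ᵐ-trans (<⇒≤ (<ᵐ-just⇒< e<f)) f<φg

PrecUp-trans-keepˡ : InFamily 𝓖 Id →
  PrecUp 𝓕 𝓑 𝒞 e f → PrecUp 𝓖 𝒞 𝒟 f g → PrecUp 𝓕 𝓑 𝒟 e g
PrecUp-trans-keepˡ {e = e} {f = f} {g = g} Id∈𝓖 (dense₁ , l₁ , rec₁ , uniform₁) (dense₂ , _)
  with dense₂ Id Id∈𝓖 AdmissibleUp-Id
... | f<g@(l₂ , rec₂ , w₂) =
  (λ φ φ∈𝓕 admφ → ConstructivelyDense-trans (combine admφ) (dense₁ φ φ∈𝓕 admφ) f<g)
  , (λ i j → l₂ (l₁ i j)) , Recursive₁-∘₂ rec₂ rec₁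
  , λ i j admᵢ → DenseWitnessOf-trans (combine admᵢ) (uniform₁ i j admᵢ) (w₂ (l₁ i j))
  where
  combine : AdmissibleUp φ → ∀ x → LtAt e φ f x → LtAt f Id g x → LtAt e φ g x
  combine (total , _ , mono) x e<φf f<g = <ᵐ-≤-trans total mono e<φf (<⇒≤ (<ᵐ-just⇒< f<g))

-- x ↦ max(0, φ(max(0, x − d)) − c), both translations of the paper at once. It is opaque so
-- that Agda can read c, d and φ off a hypothesis ψ ≗ translate c d φ.
opaque
  translate : ℕ → ℕ → Partial → Partial
  translate c d φ x = Maybe.map (_∸ c) (φ (x ∸ d))

  translate-≗ : translate c d φ ≗ Maybe.map (_∸ c) ∘ φ ∘ (_∸ d)
  translate-≗ x = refl

translate-just : ψ ≗ translate c d φ → ψ x ≡ just w →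
  ∃ λ v → φ (x ∸ d) ≡ just v × w ≡ v ∸ c
translate-just {d = d} {φ} {x} ψ≗ eq
  with φ (x ∸ d) | trans (sym (trans (ψ≗ x) (translate-≗ x))) eq
... | just v | eq′ = v , refl , sym (just-injective eq′)

Total-translate : ψ ≗ translate c d φ → Total φ → Total ψ
Total-translate {c = c} {d} ψ≗ total x =
  let v , eq = total (x ∸ d)
  in v ∸ c , trans (ψ≗ x) (trans (translate-≗ x) (cong (Maybe.map (_∸ c)) eq))

TendsToInfinity-translate : ψ ≗ translate c d φ → TendsToInfinity φ → TendsToInfinity ψ
TendsToInfinity-translate {c = c} {d} ψ≗ tends n =
  let N , large = tends (n + c) in
  N + d , λ x w N+d≤x eq →
    let v , eqv , w≡ = translate-just ψ≗ eq
    in subst (n ≤_) (sym w≡) (m+n≤o⇒m≤o∸n n (large (x ∸ d) v (m+n≤o⇒m≤o∸n N N+d≤x) eqv))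

MonotoneIncrP-translate : ψ ≗ translate c d φ → MonotoneIncrP φ → MonotoneIncrP ψ
MonotoneIncrP-translate {c = c} {d} ψ≗ mono x y w₁ w₂ x≤y eq₁ eq₂ =
  let v₁ , eqv₁ , w₁≡ = translate-just ψ≗ eq₁
      v₂ , eqv₂ , w₂≡ = translate-just ψ≗ eq₂
  in subst₂ _≤_ (sym w₁≡) (sym w₂≡)
       (∸-monoˡ-≤ c (mono (x ∸ d) (y ∸ d) v₁ v₂ (∸-monoˡ-≤ d x≤y) eqv₁ eqv₂))

Admissible-translate : ψ ≗ translate c d φ → Admissible φ → Admissible ψ
Admissible-translate ψ≗ (total , tends) =
  Total-translate ψ≗ total , TendsToInfinity-translate ψ≗ tends

AdmissibleUp-translate : ψ ≗ translate c d φ → AdmissibleUp φ → AdmissibleUp ψ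
AdmissibleUp-translate ψ≗ (total , tends , mono) =
  Total-translate ψ≗ total , TendsToInfinity-translate ψ≗ tends , MonotoneIncrP-translate ψ≗ mono

m<n∸o⇒m+o<n : ∀ m n o → m < n ∸ o → m + o < n
m<n∸o⇒m+o<n m n o m<n∸o = m≤o∸n⇒m+n≤o (suc m) o≤n m<n∸o
  where
  o≤n : o ≤ n
  o≤n = <⇒≤ (m∸n≢0⇒n<m λ n∸o≡0 → n≮0 (subst (m <_) n∸o≡0 m<n∸o))

<ᵐ-untranslate : ψ ≗ translate c d φ → k ≤ n + c → n <ᵐ ψ y → k <ᵐ φ (y ∸ d)
<ᵐ-untranslate {c = c} {n = n} ψ≗ k≤n+c (w , eq , n<w) =
  let v , eqv , w≡ = translate-just ψ≗ eq
  in v , eqv , ≤-<-trans k≤n+c (m<n∸o⇒m+o<n n v c (subst (n <_) w≡ n<w))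

ClosedUnderTranslate : ℕ → ℕ → Family → Set
ClosedUnderTranslate c d 𝓕 =
  (∀ φ → InFamily 𝓕 φ → InFamily 𝓕 (translate c d φ))
  × (Σ (ℕ → ℕ) λ τ → Recursive₁ τ × (∀ i → 𝓕 (τ i) ≗ translate c d (𝓕 i)))

InFamily-resp-≗ : φ ≗ ψ → InFamily 𝓕 φ → InFamily 𝓕 ψ
InFamily-resp-≗ φ≗ψ (i , spec) = i , λ x → trans (spec x) (φ≗ψ x)

ClosedNegOut⇒ClosedUnderTranslate : ClosedNegOut 𝓕 → ∀ c → ClosedUnderTranslate c 0 𝓕
ClosedNegOut⇒ClosedUnderTranslate (closed , θ , recθ , θ-spec) c =
  (λ φ φ∈𝓕 → InFamily-resp-≗ (sym ∘ translate-≗) (closed φ c φ∈𝓕))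
  , (λ i → θ i c) , Recursive₂-fixʳ recθ c , λ i x → trans (θ-spec i c x) (sym (translate-≗ x))

ClosedNeg⇒ClosedUnderTranslate : ClosedNegOut 𝓕 → ClosedNegIn 𝓕 → ∀ c d → ClosedUnderTranslate c d 𝓕
ClosedNeg⇒ClosedUnderTranslate {𝓕} (closedOut , θ , recθ , θ-spec) (closedIn , ζ , recζ , ζ-spec)
                               c d =
  (λ φ φ∈𝓕 → InFamily-resp-≗ (sym ∘ translate-≗) (closedOut _ c (closedIn φ d φ∈𝓕)))
  , (λ i → θ (ζ i d) c) , Recursive₁-∘ (Recursive₂-fixʳ recθ c) (Recursive₂-fixʳ recζ d)
  , λ i x → begin
      𝓕 (θ (ζ i d) c) x                    ≡⟨ θ-spec (ζ i d) c x ⟩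
      Maybe.map (_∸ c) (𝓕 (ζ i d) x)       ≡⟨ cong (Maybe.map (_∸ c)) (ζ-spec i d x) ⟩
      Maybe.map (_∸ c) (𝓕 i (x ∸ d))       ≡⟨ translate-≗ x ⟨
      translate c d (𝓕 i) x                ∎
  where open ≡-Reasoning

PrecWith-translate :
  (∀ {φ ψ} → ψ ≗ translate c d φ → Adm φ → Adm ψ) →
  (∀ {φ ψ} → ψ ≗ translate c d φ → Adm φ → ∀ x → LtAt f ψ g x → LtAt e φ h x) →
  ClosedUnderTranslate c d 𝓕 → PrecWith Adm 𝓕 𝒞 𝒟 f g → PrecWith Adm 𝓕 𝒞 𝒟 e h
PrecWith-translate {c = c} {d} adm-translate transfer (closed , τ , recτ , τ-spec)
                   (dense , l , recl , uniform) =
  (λ φ φ∈𝓕 admφ → ConstructivelyDense-weaken (transfer (λ _ → refl) admφ)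
                     (dense (translate c d φ) (closed φ φ∈𝓕) (adm-translate (λ _ → refl) admφ)))
  , (λ i j → l (τ i) j) , Recursive₂-∘ˡ recl recτ
  , λ i j admᵢ → DenseWitnessOf-weaken (transfer (τ-spec i) admᵢ)
                   (uniform (τ i) j (adm-translate (τ-spec i) admᵢ))

Prec-resp-≤ctˡ : ClosedNegOut 𝓕 → e ≤ct f → Prec 𝓕 𝒞 𝒟 f g → Prec 𝓕 𝒞 𝒟 e g
Prec-resp-≤ctˡ closed (c , e≤f+c) =
  PrecWith-translate Admissible-translate (λ ψ≗ _ x → <ᵐ-untranslate ψ≗ (e≤f+c x))
    (ClosedNegOut⇒ClosedUnderTranslate closed c)

PrecUp-resp-≤ct : ClosedNegOut 𝓕 → ClosedNegIn 𝓕 →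
  e ≤ct f → PrecUp 𝓕 𝒞 𝒟 f g → g ≤ct h → PrecUp 𝓕 𝒞 𝒟 e h
PrecUp-resp-≤ct {e = e} {f = f} {g = g} {h = h} closedOut closedIn (c , e≤f+c) f≺g (d , g≤h+d) =
  PrecWith-translate AdmissibleUp-translate transfer
    (ClosedNeg⇒ClosedUnderTranslate closedOut closedIn c d) f≺g
  where
  transfer : ∀ {φ ψ} → ψ ≗ translate c d φ → AdmissibleUp φ → ∀ x → LtAt f ψ g x → LtAt e φ h x
  transfer ψ≗ (total , _ , mono) x f<ψg =
    <ᵐ-≤-trans total mono (<ᵐ-untranslate ψ≗ (e≤f+c x) f<ψg)
      (m≤n+o⇒m∸n≤o (g x) d (subst (g x ≤_) (+-comm (h x) d) (g≤h+d x)))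

W-zero : ∀ x → W 0 x
W-zero x = 0 , ⇓zero

-- the Gödel number of μy. S(Z(y, x)), which converges nowhere
emptyIndex : ℕ
emptyIndex = 12241

dec-emptyIndex : dec 1 emptyIndex ≡ muF (compF succF (zeroF ∷ []))
dec-emptyIndex = refl

W-emptyIndex : ∀ x → ¬ W emptyIndex x
W-emptyIndex x (v , x∈W) with subst (λ p → p ⊢ x ∷ [] ⇓ v) dec-emptyIndex x∈W
... | ⇓mu (⇓comp (∷⇓ ⇓zero []⇓) ()) _

WC-∃≤-universal : ∀ {μ μ↑} k → (∀ x → ¬ W k x) → ∀ x → WC ∃≤[ μ , μ↑ ]Σ⁰₁∧Π⁰₁ (pair (pair 0 k) 0) x
WC-∃≤-universal k W-empty x rewrite unpair-pair (pair 0 k) 0 | unpair-pair 0 k =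
  [] , [] , W-zero _ , W-empty _

universalIndex : ∀ 𝒞 → Σ ℕ λ j → ∀ x → WC 𝒞 j x
universalIndex Σ⁰₁ = 0 , W-zero
universalIndex Π⁰₁ = emptyIndex , W-emptyIndex
universalIndex Σ⁰₁∨Π⁰₁ = 0 , λ x → inj₁ (W-zero x)
universalIndex ∃≤[ μ , μ↑ ]Σ⁰₁∧Π⁰₁ =
  pair (pair 0 emptyIndex) 0 , WC-∃≤-universal {μ} {μ↑} emptyIndex W-emptyIndex

ConstructivelyDense-nonempty : ConstructivelyDense 𝒞 𝒟 P → ∃ P
ConstructivelyDense-nonempty {𝒞} (l , _ , w) =
  let j , univ = universalIndex 𝒞
      infD , sub = w j (λ n → n , ≤-refl , univ n)
      x , _ , xD = infD 0
  in x , proj₂ (sub x xD)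

PrecWith-irrefl : InFamily 𝓕 Id → Adm Id → ¬ PrecWith Adm 𝓕 𝒞 𝒟 u u
PrecWith-irrefl Id∈𝓕 admId (dense , _) =
  let x , u<u = ConstructivelyDense-nonempty (dense Id Id∈𝓕 admId)
  in <-irrefl refl (<ᵐ-just⇒< u<u)

mainTheorem1 : (𝓑 𝒞 𝒟 : SynClass) (𝓕 𝓖 : Family) →
    InFamily 𝓕 Id → InFamily 𝓖 Id →
    (e f g h : ℕ → ℕ) →
    (Prec 𝓕 𝓑 𝒞 e f → Prec 𝓖 𝒞 𝒟 f g → Prec 𝓖 𝓑 𝒟 e g)
    × (PrecUp 𝓕 𝓑 𝒞 e f → PrecUp 𝓖 𝒞 𝒟 f g → PrecUp 𝓖 𝓑 𝒟 e g × PrecUp 𝓕 𝓑 𝒟 e g)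
    × (ClosedNegOut 𝓕 → e ≤ct f → Prec 𝓕 𝒞 𝒟 f g → Prec 𝓕 𝒞 𝒟 e g)
    × (ClosedNegOut 𝓕 → ClosedNegIn 𝓕 → e ≤ct f → PrecUp 𝓕 𝒞 𝒟 f g → g ≤ct h → PrecUp 𝓕 𝒞 𝒟 e h)
    × (∀ (𝓒 : SynClass) →
    ((∀ (u : ℕ → ℕ) → ¬ Prec 𝓕 𝓒 𝓒 u u)
    × (∀ (u v w : ℕ → ℕ) → Prec 𝓕 𝓒 𝓒 u v → Prec 𝓕 𝓒 𝓒 v w → Prec 𝓕 𝓒 𝓒 u w))
    × ((∀ (u : ℕ → ℕ) → ¬ PrecUp 𝓕 𝓒 𝓒 u u)
    × (∀ (u v w : ℕ → ℕ) → PrecUp 𝓕 𝓒 𝓒 u v → PrecUp 𝓕 𝓒 𝓒 v w → PrecUp 𝓕 𝓒 𝓒 u w)))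
mainTheorem1 𝓑 𝒞 𝒟 𝓕 𝓖 Id∈𝓕 Id∈𝓖 e f g h =
  PrecWith-trans Id∈𝓕 Admissible-Id
  , (λ e≺f f≺g → PrecWith-trans Id∈𝓕 AdmissibleUp-Id e≺f f≺g , PrecUp-trans-keepˡ Id∈𝓖 e≺f f≺g)
  , Prec-resp-≤ctˡ
  , PrecUp-resp-≤ct
  , λ 𝓒 → ( (λ u → PrecWith-irrefl Id∈𝓕 Admissible-Id)
            , (λ u v w → PrecWith-trans Id∈𝓕 Admissible-Id) )
        , ( (λ u → PrecWith-irrefl Id∈𝓕 AdmissibleUp-Id)
            , (λ u v w → PrecWith-trans Id∈𝓕 AdmissibleUp-Id) )
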